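{- Let $(F_n)_{n\ge 0}$ be the Fibonacci sequence. The triples of integers $(n,d,m)$ with $n\ge 1$, $d\ge 0$, $m\ge 1$ satisfying \[F_n^2+F_{n+d}^2=F_m\] are exactly \[(n,d,m)\in\{(1,2,5),\ (1,0,3),\ (2,0,3),\ (3,0,6)\}\cup\{(n,1,2n+1): n\ge 1\}.\]
   Context: The Fibonacci sequence is defined by $F_0=0$, $F_1=1$ and $F_{n+2}=F_{n+1}+F_n$ for $n\ge 0$. -}

module Defs where

open import Data.Nat using (ℕ; zero; suc; _+_; _*_; _≤_)
open import Data.Sum using (_⊎_)
open import Data.Product using (_×_)
open import Relation.Binary.PropositionalEquality using (_≡_)

fib : ℕ → ℕ
fib zero = 0
fib (suc zero) = 1
fib (suc (suc n)) = fib (suc n) + fib n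

InSolutionSet : ℕ → ℕ → ℕ → Set
InSolutionSet n d m =
  (n ≡ 1 × d ≡ 2 × m ≡ 5) ⊎
  (n ≡ 1 × d ≡ 0 × m ≡ 3) ⊎
  (n ≡ 2 × d ≡ 0 × m ≡ 3) ⊎
  (n ≡ 3 × d ≡ 0 × m ≡ 6) ⊎
  (1 ≤ n × d ≡ 1 × m ≡ 2 * n + 1)

-- Everything rests on the doubling formulas F(2k+1) = F(k+1)² + F(k)² and
-- F(2k+2) + F(k)² = F(k+2)². For d = 1 the first one is exactly the equation.
-- For d ≥ 2 the sum F(n)² + F(k+2)² (k = n+d-2) lies strictly between
-- F(2k+2) and F(2k+3) as soon as 1 ≤ F(n) < F(k+1), which fails only for
-- (n,d) = (1,2). For d = 0 and n ≥ 4, 2F(n)² lies strictly between F(2n-1)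
-- and F(2n). A number strictly between consecutive Fibonacci numbers is not
-- one, and from index 3 on F is injective, which pins down m in the rest.
module Submission where

open import Defs
open import Data.Nat using (ℕ; zero; suc; _+_; _*_; _≤_; _<_; z≤n; s≤s; _≤′_; ≤′-refl; ≤′-step; >-nonZero)
open import Data.Nat.Properties
open import Data.Nat.Tactic.RingSolver using (solve-∀)
open import Data.Product using (_,_)
open import Data.Sum using (inj₁; inj₂)
open import Data.Empty using (⊥-elim)
open import Function.Bundles using (_⇔_; mk⇔)
open import Relation.Nullary using (yes; no)
open import Relation.Binary using (tri<; tri≈; tri>)
open import Relation.Binary.PropositionalEquality
  using (_≡_; _≢_; refl; sym; trans; cong; subst; module ≡-Reasoning)

fib-+ : ∀ m n → fib (suc (m + n)) ≡ fib (suc m) * fib (suc n) + fib m * fib n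
fib-+ zero n = sym (trans (+-identityʳ _) (+-identityʳ _))
fib-+ (suc zero) n = unit (fib (suc n)) (fib n)
  where
  unit : ∀ a b → a + b ≡ 1 * a + 1 * b
  unit = solve-∀
fib-+ (suc (suc m)) n rewrite fib-+ (suc m) n | fib-+ m n =
  recombine (fib (suc m)) (fib m) (fib (suc n)) (fib n)
  where
  recombine : ∀ b c p q → ((b + c) * p + b * q) + (b * p + c * q) ≡ ((b + c) + b) * p + (b + c) * q
  recombine = solve-∀

fib-odd : ∀ k → fib (suc (k + k)) ≡ fib (suc k) * fib (suc k) + fib k * fib k
fib-odd k = fib-+ k k

fib-even : ∀ k → fib (suc (suc (k + k))) + fib k * fib k ≡ fib (suc (suc k)) * fib (suc (suc k))
fib-even k rewrite fib-+ (suc k) k = square (fib (suc k)) (fib k)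
  where
  square : ∀ y x → ((y + x) * y + y * x) + x * x ≡ (y + x) * (y + x)
  square = solve-∀

fib-pos : ∀ n → 0 < fib (suc n)
fib-pos zero = s≤s z≤n
fib-pos (suc n) = ≤-trans (fib-pos n) (m≤m+n _ _)

fib-≤-suc : ∀ n → fib n ≤ fib (suc n)
fib-≤-suc zero = z≤n
fib-≤-suc (suc zero) = ≤-refl
fib-≤-suc (suc (suc n)) = m≤m+n _ _

fib-<-suc : ∀ {n} → 2 ≤ n → fib n < fib (suc n)
fib-<-suc {suc (suc n)} (s≤s (s≤s z≤n)) = m<m+n _ (fib-pos n)

fib-mono-≤′ : ∀ {m n} → m ≤′ n → fib m ≤ fib n
fib-mono-≤′ ≤′-refl = ≤-refl
fib-mono-≤′ {n = suc n} (≤′-step m≤′n) = ≤-trans (fib-mono-≤′ m≤′n) (fib-≤-suc n)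

fib-mono-≤ : ∀ {m n} → m ≤ n → fib m ≤ fib n
fib-mono-≤ m≤n = fib-mono-≤′ (≤⇒≤′ m≤n)

fib-mono-< : ∀ {m n} → 2 ≤ m → m < n → fib m < fib n
fib-mono-< 2≤m m<n = <-≤-trans (fib-<-suc 2≤m) (fib-mono-≤ m<n)

fib-injective : ∀ {m} n → 3 ≤ n → fib m ≡ fib n → m ≡ n
fib-injective {m} (suc n) (s≤s 2≤n) eq with <-cmp m (suc n)
... | tri< (s≤s m≤n) _ _ = ⊥-elim (<-irrefl eq (≤-<-trans (fib-mono-≤ m≤n) (fib-<-suc 2≤n)))
... | tri≈ _ m≡n _ = m≡n
... | tri> _ _ n<m = ⊥-elim (<-irrefl (sym eq) (fib-mono-< (≤-trans 2≤n (n≤1+n n)) n<m))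

fib≢-between : ∀ {x} m j → fib j < x → x < fib (suc j) → fib m ≢ x
fib≢-between m j lower upper refl with m ≤? j
... | yes m≤j = <-irrefl refl (<-≤-trans lower (fib-mono-≤ m≤j))
... | no m≰j = <-irrefl refl (<-≤-trans upper (fib-mono-≤ (≰⇒> m≰j)))

sq+fib-sq≢fib : ∀ m k a → 0 < a → a < fib (suc k) →
  fib m ≢ a * a + fib (suc (suc k)) * fib (suc (suc k))
sq+fib-sq≢fib m k a 0<a a<fk+1 = fib≢-between m (suc (suc (k + k))) lower upper
  where
  z = fib (suc (suc k))
  lower : fib (suc (suc (k + k))) < a * a + z * z
  lower = begin-strict
    fib (suc (suc (k + k)))                 ≤⟨ m≤m+n _ _ ⟩
    fib (suc (suc (k + k))) + fib k * fib k ≡⟨ fib-even k ⟩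
    z * z                                   <⟨ m<n+m _ (*-mono-≤ 0<a 0<a) ⟩
    a * a + z * z                           ∎
    where open ≤-Reasoning
  upper : a * a + z * z < fib (suc (suc (suc (k + k))))
  upper = begin-strict
    a * a + z * z                           <⟨ +-monoˡ-< (z * z) (*-mono-< a<fk+1 a<fk+1) ⟩
    fib (suc k) * fib (suc k) + z * z       ≡⟨ +-comm _ (z * z) ⟩
    z * z + fib (suc k) * fib (suc k)       ≡⟨ fib-odd (suc k) ⟨
    fib (suc (suc k + suc k))               ≡⟨ cong (λ i → fib (suc (suc i))) (+-suc k k) ⟩
    fib (suc (suc (suc (k + k))))           ∎
    where open ≤-Reasoning

-- x = F(p), w = F(p-1), y = F(p+1); the upper bound F(2p+2) = y² + 2xy needs w < x, i.e. p ≥ 3.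
fib-sq+fib-sq≢fib : ∀ m p → 3 ≤ p → fib m ≢ fib (suc p) * fib (suc p) + fib (suc p) * fib (suc p)
fib-sq+fib-sq≢fib m (suc p) (s≤s 2≤p) = fib≢-between m (suc (suc p + suc p)) lower upper
  where
  w = fib p
  x = fib (suc p)
  y = x + w
  x<y : x < y
  x<y = fib-<-suc (≤-trans 2≤p (n≤1+n p))
  y<x+x : y < x + x
  y<x+x = +-monoʳ-< x (fib-<-suc 2≤p)
  split : ∀ x y → (y + x) * y + y * x ≡ y * y + y * (x + x)
  split = solve-∀
  lower : fib (suc (suc p + suc p)) < y * y + y * y
  lower rewrite fib-odd (suc p) = +-monoʳ-< (y * y) (*-mono-< x<y x<y)
  upper : y * y + y * y < fib (suc (suc (suc p + suc p)))
  upper rewrite fib-+ (suc (suc p)) (suc p) | split x y =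
    +-monoʳ-< (y * y) (*-monoʳ-< y {{>-nonZero (≤-<-trans z≤n x<y)}} y<x+x)

fib-sq+fib-suc-sq : ∀ n → fib n * fib n + fib (n + 1) * fib (n + 1) ≡ fib (2 * n + 1)
fib-sq+fib-suc-sq n = begin
  fib n * fib n + fib (n + 1) * fib (n + 1) ≡⟨ cong (λ i → fib n * fib n + fib i * fib i) (+-comm n 1) ⟩
  fib n * fib n + fib (suc n) * fib (suc n) ≡⟨ +-comm (fib n * fib n) _ ⟩
  fib (suc n) * fib (suc n) + fib n * fib n ≡⟨ fib-odd n ⟨
  fib (suc (n + n))                         ≡⟨ cong fib (double n) ⟩
  fib (2 * n + 1)                           ∎
  where
  open ≡-Reasoning
  double : ∀ n → suc (n + n) ≡ 2 * n + 1
  double = solve-∀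

solutions-d≡0 : ∀ {m} n → 1 ≤ n → fib n * fib n + fib n * fib n ≡ fib m → InSolutionSet n 0 m
solutions-d≡0 1 _ eq = inj₂ (inj₁ (refl , refl , fib-injective 3 ≤-refl (sym eq)))
solutions-d≡0 2 _ eq = inj₂ (inj₂ (inj₁ (refl , refl , fib-injective 3 ≤-refl (sym eq))))
solutions-d≡0 3 _ eq = inj₂ (inj₂ (inj₂ (inj₁ (refl , refl , fib-injective 6 (s≤s (s≤s (s≤s z≤n))) (sym eq)))))
solutions-d≡0 {m} (suc (suc (suc (suc q)))) _ eq = ⊥-elim (fib-sq+fib-sq≢fib m (3 + q) (s≤s (s≤s (s≤s z≤n))) (sym eq))

solutions-d≡1 : ∀ {m} n → 1 ≤ n → fib n * fib n + fib (n + 1) * fib (n + 1) ≡ fib m → InSolutionSet n 1 m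
solutions-d≡1 n 1≤n eq = inj₂ (inj₂ (inj₂ (inj₂ (1≤n , refl ,
  fib-injective (2 * n + 1) (+-monoˡ-≤ 1 (*-monoʳ-≤ 2 1≤n)) (trans (sym eq) (fib-sq+fib-suc-sq n))))))

solutions-d≥2 : ∀ {m} n d → 1 ≤ n →
  fib n * fib n + fib (suc (suc (n + d))) * fib (suc (suc (n + d))) ≡ fib m → InSolutionSet n (2 + d) m
solutions-d≥2 1 zero _ eq = inj₁ (refl , refl , fib-injective 5 (s≤s (s≤s (s≤s z≤n))) (sym eq))
solutions-d≥2 {m} 1 (suc d) _ eq =
  ⊥-elim (sq+fib-sq≢fib m (2 + d) 1 (s≤s z≤n) (fib-mono-< {2} {3 + d} ≤-refl (s≤s (s≤s (s≤s z≤n)))) (sym eq))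
solutions-d≥2 {m} n@(suc (suc n′)) d _ eq =
  ⊥-elim (sq+fib-sq≢fib m (n + d) (fib n) (fib-pos (suc n′)) (fib-mono-< (s≤s (s≤s z≤n)) (s≤s (m≤m+n n d))) (sym eq))

solutions-sound : ∀ {n d m} → InSolutionSet n d m → fib n * fib n + fib (n + d) * fib (n + d) ≡ fib m
solutions-sound (inj₁ (refl , refl , refl)) = refl
solutions-sound (inj₂ (inj₁ (refl , refl , refl))) = refl
solutions-sound (inj₂ (inj₂ (inj₁ (refl , refl , refl)))) = refl
solutions-sound (inj₂ (inj₂ (inj₂ (inj₁ (refl , refl , refl))))) = refl
solutions-sound {n} (inj₂ (inj₂ (inj₂ (inj₂ (_ , refl , refl))))) = fib-sq+fib-suc-sq n

theorem3p2 : (n d m : ℕ) → 1 ≤ n → 1 ≤ m →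
    ((fib n * fib n + fib (n + d) * fib (n + d) ≡ fib m) ⇔ InSolutionSet n d m)
theorem3p2 n d m 1≤n _ = mk⇔ (complete d) solutions-sound
  where
  complete : ∀ d → fib n * fib n + fib (n + d) * fib (n + d) ≡ fib m → InSolutionSet n d m
  complete zero eq = solutions-d≡0 n 1≤n (subst (λ i → fib n * fib n + fib i * fib i ≡ fib m) (+-identityʳ n) eq)
  complete (suc zero) eq = solutions-d≡1 n 1≤n eq
  complete (suc (suc d)) eq rewrite +-suc n (suc d) | +-suc n d = solutions-d≥2 n d 1≤n eq
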